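{- Let $G$ be a connected chordal claw-free graph with clique tree $T_G=(\mathcal M,\mathcal E)$. If a max clique $B\in\mathcal M$ has a fork triangle, then the degree of $B$ in $T_G$ is $3$.
   Context: Graphs are finite simple undirected. A graph is chordal if every cycle of length at least 4 has a chord, and claw-free if it has no induced $K_{1,3}$. A max clique is an inclusion-maximal clique; $\mathcal M$ is the set of max cliques and $\mathcal M_v$ the set of max cliques containing $v$. A clique tree is a tree on $\mathcal M$ in which each $T[\mathcal M_v]$ is connected; a connected chordal claw-free graph has exactly one clique tree $T_G$, and each $T_G[\mathcal M_v]$ is a path. Max cliques $A_1,A_2,A_3$ form a fork triangle around $B$ if they are distinct neighbours of $B$ in $T_G$ and there are vertices $u,v,w$ of $G$ with $\mathcal M_u=\{A_1,B,A_2\}$, $\mathcal M_v=\{A_2,B,A_3\}$, $\mathcal M_w=\{A_3,B,A_1\}$; $B$ has a fork triangle if some such $A_1,A_2,A_3$ exist. -}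

module Defs where

open import Data.Nat using (ℕ; suc; _+_; _<_; _≤_)
open import Data.Bool using (Bool; true; false)
open import Data.Fin using (Fin; toℕ; zero)
open import Data.Fin.Subset using (Subset; _∈_; _∉_; _⊆_; ∣_∣)
open import Data.Vec using (tabulate)
open import Data.List using (List; []; _∷_; length; lookup)
open import Data.List.Relation.Unary.Linked using (Linked)
open import Data.List.Relation.Unary.All using (All)
open import Data.List.Relation.Unary.Unique.Propositional using (Unique)
open import Data.Product using (Σ; ∃; _×_; _,_)
open import Data.Sum using (_⊎_)
open import Relation.Binary.PropositionalEquality using (_≡_; _≢_)
open import Relation.Nullary using (¬_)
open import Data.Empty using (⊥)

record Graph (n : ℕ) : Set where
  field
    adj   : Fin n → Fin n → Bool
    sym   : ∀ u v → adj u v ≡ adj v u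
    irref : ∀ v → adj v v ≡ false

Adj : ∀ {k} → (Fin k → Fin k → Bool) → Fin k → Fin k → Set
Adj R u v = R u v ≡ true

lastOf : ∀ {A : Set} → A → List A → A
lastOf x []       = x
lastOf x (y ∷ ys) = lastOf y ys

WalkWithin : ∀ {k} → (Fin k → Fin k → Bool) → (Fin k → Set) → Fin k → Fin k → Set
WalkWithin R P u v =
  Σ (List _) λ xs → Linked (Adj R) (u ∷ xs) × All P (u ∷ xs) × lastOf u xs ≡ v

Walk : ∀ {k} → (Fin k → Fin k → Bool) → Fin k → Fin k → Set
Walk R u v =
  Σ (List _) λ xs → Linked (Adj R) (u ∷ xs) × lastOf u xs ≡ v

Connected : ∀ {k} → (Fin k → Fin k → Bool) → Set
Connected R = ∀ u v → Walk R u v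

IsCycle : ∀ {k} → (Fin k → Fin k → Bool) → List (Fin k) → Set
IsCycle R []       = ⊥
IsCycle R (x ∷ ys) =
  3 ≤ length (x ∷ ys) × Unique (x ∷ ys) × Linked (Adj R) (x ∷ ys)
  × Adj R (lastOf x ys) x

-- A chord of a cycle cs: an edge between two vertices of cs that are
-- not consecutive on the cycle (cyclically).
HasChord : ∀ {k} → (Fin k → Fin k → Bool) → List (Fin k) → Set
HasChord R cs =
  Σ (Fin (length cs)) λ i → Σ (Fin (length cs)) λ j →
    suc (toℕ i) < toℕ j
    × ¬ (toℕ i ≡ 0 × suc (toℕ j) ≡ length cs)
    × Adj R (lookup cs i) (lookup cs j)

Acyclic : ∀ {k} → (Fin k → Fin k → Bool) → Set
Acyclic R = ∀ cs → ¬ IsCycle R cs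

module _ {n : ℕ} (G : Graph n) where
  open Graph G

  GConnected : Set
  GConnected = Connected adj

  Chordal : Set
  Chordal = ∀ cs → IsCycle adj cs → 4 ≤ length cs → HasChord adj cs

  ClawFree : Set
  ClawFree = ∀ c a b d →
    Adj adj c a → Adj adj c b → Adj adj c d →
    a ≢ b → b ≢ d → a ≢ d →
    ¬ (adj a b ≡ false × adj b d ≡ false × adj a d ≡ false)

  IsClique : Subset n → Set
  IsClique S = ∀ u v → u ∈ S → v ∈ S → u ≢ v → Adj adj u v

  IsMaxClique : Subset n → Set
  IsMaxClique S = IsClique S × (∀ S' → IsClique S' → S ⊆ S' → S' ⊆ S)

  record MaxCliqueEnum (m : ℕ) : Set where
    field
      clq      : Fin m → Subset n
      injective : ∀ i j → clq i ≡ clq j → i ≡ j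
      isMax    : ∀ i → IsMaxClique (clq i)
      complete : ∀ S → IsMaxClique S → ∃ λ i → clq i ≡ S

  module _ {m : ℕ} (𝓜 : MaxCliqueEnum m) where
    open MaxCliqueEnum 𝓜

    𝓜[_] : Fin n → Fin m → Set
    𝓜[ v ] i = v ∈ clq i

    record IsCliqueTree (E : Fin m → Fin m → Bool) : Set where
      field
        sym       : ∀ i j → E i j ≡ E j i
        irref     : ∀ i → E i i ≡ false
        connected : Connected E
        acyclic   : Acyclic E
        subtree   : ∀ v i j → 𝓜[ v ] i → 𝓜[ v ] j → WalkWithin E 𝓜[ v ] i j

    𝓜Is : Fin n → Fin m → Fin m → Fin m → Set
    𝓜Is u X Y Z = ∀ i → (𝓜[ u ] i → (i ≡ X ⊎ i ≡ Y ⊎ i ≡ Z))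
                       × ((i ≡ X ⊎ i ≡ Y ⊎ i ≡ Z) → 𝓜[ u ] i)

    ForkTriangle : (E : Fin m → Fin m → Bool) → Fin m → Fin m → Fin m → Fin m → Set
    ForkTriangle E B A₁ A₂ A₃ =
      A₁ ≢ A₂ × A₂ ≢ A₃ × A₁ ≢ A₃
      × Adj E B A₁ × Adj E B A₂ × Adj E B A₃
      × (∃ λ u → 𝓜Is u A₁ B A₂)
      × (∃ λ v → 𝓜Is v A₂ B A₃)
      × (∃ λ w → 𝓜Is w A₃ B A₁)

    HasForkTriangle : (E : Fin m → Fin m → Bool) → Fin m → Set
    HasForkTriangle E B = ∃ λ A₁ → ∃ λ A₂ → ∃ λ A₃ → ForkTriangle E B A₁ A₂ A₃

    degree : (E : Fin m → Fin m → Bool) → Fin m → ℕ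
    degree E B = ∣ tabulate (E B) ∣

-- We show that every neighbour J of B is one of the Aᵢ, and then count.
-- For x ∈ B ∩ J, the fork vertices u, v, w put x in two of the Aᵢ, so J
-- is one of them; the degree is then the size of {A₁, A₂, A₃}.

module Submission where

open import Defs
open import Data.Nat using (ℕ)
open import Data.Fin using (Fin)
open import Data.Bool using (Bool)
open import Relation.Binary.PropositionalEquality using (_≡_)

open import Data.Nat using (suc; s≤s; z≤n)
open import Data.Fin using (_≟_)
open import Data.Bool using (true; false) renaming (_≟_ to _≟ᵇ_)
open import Data.Fin.Subset using (Subset; _∈_; _∉_; _⊆_; ∣_∣; _∪_; ⁅_⁆; _-_; Empty; inside; outside)
open import Data.Fin.Subset.Properties
  using (_∈?_; x∈⁅x⁆; x∈⁅y⁆⇒x≡y; ⊆-antisym; x∈p∪q⁻; x∈p∪q⁺; p─⊥≡p; ∣⊥∣≡0; Empty-unique;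
         x∈p∧x≢y⇒x∈p-y; p─q⊆p)
open import Data.Fin.Properties using (any?; all?)
open import Data.Vec using (tabulate; []; _∷_)
import Data.Vec as Vec
open import Data.Vec.Properties using (lookup∘tabulate; lookup⇒[]=; []=⇒lookup)
open import Data.List using (List; []; _∷_; length; allFin)
open import Data.List.Relation.Unary.Linked using (Linked; []; [-]; _∷_)
open import Data.List.Relation.Unary.All as All using (All; []; _∷_)
open import Data.List.Relation.Unary.All.Properties using (¬Any⇒All¬)
open import Data.List.Relation.Unary.Any using (here; there)
open import Data.List.Relation.Unary.AllPairs using ([]; _∷_)
open import Data.List.Relation.Unary.Unique.Propositional using (Unique)
open import Data.List.Membership.Propositional using () renaming (_∈_ to _∈ₗ_)
open import Data.List.Membership.Propositional.Properties using (∈-allFin)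
open import Data.Product using (Σ; _×_; _,_; proj₁; proj₂)
open import Data.Sum using (_⊎_; inj₁; inj₂; map₂)
open import Data.Unit using (⊤; tt)
open import Data.Empty using (⊥; ⊥-elim)
open import Relation.Binary.PropositionalEquality using (refl; sym; trans; subst; cong; _≢_)
open import Relation.Nullary using (¬_; Dec; yes; no)
open import Relation.Nullary.Decidable using (_×-dec_; _→-dec_; ¬?; decidable-stable)

¬true⇒false : ∀ {b : Bool} → ¬ (b ≡ true) → b ≡ false
¬true⇒false {false} _ = refl
¬true⇒false {true}  h = ⊥-elim (h refl)

∣p∣≡1+∣p-x∣ : ∀ {n} {p : Subset n} {x} → x ∈ p → ∣ p ∣ ≡ suc ∣ p - x ∣
∣p∣≡1+∣p-x∣ {p = inside ∷ p}  Vec.here        = cong suc (sym (cong ∣_∣ (p─⊥≡p p)))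
∣p∣≡1+∣p-x∣ {p = inside ∷ p}  (Vec.there x∈p) = cong suc (∣p∣≡1+∣p-x∣ x∈p)
∣p∣≡1+∣p-x∣ {p = outside ∷ p} (Vec.there x∈p) = ∣p∣≡1+∣p-x∣ x∈p

x∈p-y⇒x≢y : ∀ {n} {p : Subset n} {x y} → x ∈ p - y → x ≢ y
x∈p-y⇒x≢y {p = _ ∷ p} {Fin.suc x} (Vec.there x∈p-y) refl = x∈p-y⇒x≢y {p = p} x∈p-y refl

∣p∣≡length : ∀ {n} {p : Subset n} (xs : List (Fin n)) → Unique xs →
             (∀ {x} → x ∈ p → x ∈ₗ xs) → All (_∈ p) xs → ∣ p ∣ ≡ length xs
∣p∣≡length {n} {p} [] _ p⊆xs _ = trans (cong ∣_∣ (Empty-unique empty)) (∣⊥∣≡0 n)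
  where
  empty : Empty p
  empty (x , x∈p) with p⊆xs x∈p
  ... | ()
∣p∣≡length {p = p} (y ∷ ys) (y∉ys ∷ unique) p⊆xs (y∈p ∷ ys⊆p) =
  trans (∣p∣≡1+∣p-x∣ y∈p) (cong suc (∣p∣≡length ys unique p-y⊆ys ys⊆p-y))
  where
  p-y⊆ys : ∀ {x} → x ∈ p - y → x ∈ₗ ys
  p-y⊆ys x∈p-y with p⊆xs (p─q⊆p p ⁅ y ⁆ x∈p-y)
  ... | here x≡y  = ⊥-elim (x∈p-y⇒x≢y x∈p-y x≡y)
  ... | there x∈ys = x∈ys
  ys⊆p-y : All (_∈ p - y) ys
  ys⊆p-y = All.zipWith (λ (y≢x , x∈p) → x∈p∧x≢y⇒x∈p-y x∈p (λ x≡y → y≢x (sym x≡y))) (y∉ys , ys⊆p)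

∈-tabulate⁺ : ∀ {n} {f : Fin n → Bool} {x} → f x ≡ true → x ∈ tabulate f
∈-tabulate⁺ {f = f} {x} fx = lookup⇒[]= x (tabulate f) (trans (lookup∘tabulate f x) fx)

∈-tabulate⁻ : ∀ {n} {f : Fin n → Bool} {x} → x ∈ tabulate f → f x ≡ true
∈-tabulate⁻ {f = f} {x} x∈ = trans (sym (lookup∘tabulate f x)) ([]=⇒lookup x∈)

data Path {k} (R : Fin k → Fin k → Bool) (P : Fin k → Set) : Fin k → Fin k → Set where
  [_]   : ∀ {i} → P i → Path R P i i
  _∷⟨_⟩_ : ∀ {i j l} → P i → Adj R i j → Path R P j l → Path R P i l

infixr 5 _∷⟨_⟩_

module _ {k} {R : Fin k → Fin k → Bool} where

  infixr 5 _++_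

  fromWalkWithin : ∀ {P : Fin k → Set} {u v} → WalkWithin R P u v → Path R P u v
  fromWalkWithin (xs , linked , within , ends) = go xs linked within ends
    where
    go : ∀ {P : Fin k → Set} {u v} xs → Linked (Adj R) (u ∷ xs) → All P (u ∷ xs) →
         lastOf u xs ≡ v → Path R P u v
    go []       _          (pu ∷ []) refl = [ pu ]
    go (x ∷ xs) (r ∷ linked) (pu ∷ within) ends = pu ∷⟨ r ⟩ go xs linked within ends

  fromWalk : ∀ {u v} → Walk R u v → Path R (λ _ → ⊤) u v
  fromWalk (xs , linked , ends) = go xs linked ends
    where
    go : ∀ {u v} xs → Linked (Adj R) (u ∷ xs) → lastOf u xs ≡ v → Path R (λ _ → ⊤) u v
    go []       _            refl = [ tt ]
    go (x ∷ xs) (r ∷ linked) ends = tt ∷⟨ r ⟩ go xs linked ends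

  weaken : ∀ {P Q : Fin k → Set} {u v} → (∀ {i} → P i → Q i) → Path R P u v → Path R Q u v
  weaken f [ p ]          = [ f p ]
  weaken f (p ∷⟨ r ⟩ ps) = f p ∷⟨ r ⟩ weaken f ps

  _++_ : ∀ {P : Fin k → Set} {u v w} → Path R P u v → Path R P v w → Path R P u w
  [ _ ]         ++ qs = qs
  (p ∷⟨ r ⟩ ps) ++ qs = p ∷⟨ r ⟩ (ps ++ qs)

  start : ∀ {P : Fin k → Set} {u v} → Path R P u v → P u
  start [ p ]         = p
  start (p ∷⟨ _ ⟩ _) = p

  finish : ∀ {P : Fin k → Set} {u v} → Path R P u v → P v
  finish [ p ]          = p
  finish (_ ∷⟨ _ ⟩ ps) = finish ps

  enteringStep : ∀ {Q : Fin k → Set} {d b} → Path R Q d b → d ≢ b →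
                 Σ (Fin k) λ p → Adj R p b × Path R (λ i → Q i × i ≢ b) d p
  enteringStep [ _ ] d≢b = ⊥-elim (d≢b refl)
  enteringStep {b = b} (_∷⟨_⟩_ {i = d} {j = j} qd r ps) d≢b with j ≟ b
  ... | yes refl = d , r , [ qd , d≢b ]
  ... | no j≢b with enteringStep ps j≢b
  ...   | p , p~b , d⇝p = p , p~b , (qd , d≢b) ∷⟨ r ⟩ d⇝p

module Symmetric {k} {R : Fin k → Fin k → Bool} (R-sym : ∀ i j → R i j ≡ R j i) where
  open import Data.List.Membership.DecPropositional (_≟_ {n = k}) using () renaming (_∈?_ to _∈ₗ?_)

  flip : ∀ {i j} → Adj R i j → Adj R j i
  flip {i} {j} r = trans (R-sym j i) r

  reverse : ∀ {P : Fin k → Set} {u v} → Path R P u v → Path R P v u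
  reverse [ p ]          = [ p ]
  reverse (p ∷⟨ r ⟩ ps) = reverse ps ++ (start ps ∷⟨ flip r ⟩ [ p ])

  SimpleWalk : (Fin k → Set) → Fin k → Fin k → Set
  SimpleWalk P x y = Σ (List (Fin k)) λ xs →
    Linked (Adj R) (x ∷ xs) × Unique (x ∷ xs) × All P (x ∷ xs) × lastOf x xs ≡ y

  suffixFrom : ∀ {P x y z} (w : SimpleWalk P x y) → z ∈ₗ (x ∷ proj₁ w) → SimpleWalk P z y
  suffixFrom w (here refl) = w
  suffixFrom (_ ∷ xs , _ ∷ linked , _ ∷ unique , _ ∷ within , ends) (there z∈) =
    suffixFrom (xs , linked , unique , within , ends) z∈

  loopErase : ∀ {P x y v} → SimpleWalk P x y → Path R P x v → SimpleWalk P v y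
  loopErase w [ _ ] = w
  loopErase {x = x} w@(xs , linked , unique , within , ends) (_∷⟨_⟩_ {j = j} _ r ps)
    with j ∈ₗ? (x ∷ xs)
  ... | yes j∈ = loopErase (suffixFrom w j∈) ps
  ... | no  j∉ = loopErase (x ∷ xs , flip r ∷ linked , ¬Any⇒All¬ (x ∷ xs) j∉ ∷ unique ,
                            start ps ∷ within , ends) ps

  -- In an acyclic relation, two neighbours of b joined by a walk avoiding
  -- b coincide: otherwise the walk, made simple and closed through b,
  -- would be a cycle.
  neighboursCoincide : Acyclic R → ∀ {b p₁ p₂} → Adj R b p₁ → Adj R b p₂ →
                       Path R (_≢ b) p₁ p₂ → p₁ ≡ p₂
  neighboursCoincide acyclic {b} {p₁} {p₂} b~p₁ b~p₂ p₁⇝p₂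
    with loopErase ([] , [-] , [] ∷ [] , start p₁⇝p₂ ∷ [] , refl) p₁⇝p₂
  ... | [] , _ , _ , _ , ends = sym ends
  ... | z ∷ zs , linked , unique , within , ends =
    ⊥-elim (acyclic (b ∷ p₂ ∷ z ∷ zs)
      ( s≤s (s≤s (s≤s z≤n))
      , All.map (λ i≢b b≡i → i≢b (sym b≡i)) within ∷ unique
      , b~p₂ ∷ linked
      , subst (λ t → Adj R t b) (sym ends) (flip b~p₁)))

module MaxCliques {n m} (G : Graph n) (𝓜 : MaxCliqueEnum G m) where
  open Graph G renaming (sym to adj-sym)
  open MaxCliqueEnum 𝓜

  Extends : Subset n → Fin n → Set
  Extends S v = ∀ u → u ∈ S → u ≢ v → Adj adj u v

  extends? : ∀ S v → Dec (Extends S v)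
  extends? S v = all? (λ u → (u ∈? S) →-dec (¬? (u ≟ v) →-dec (adj u v ≟ᵇ true)))

  grow : Subset n → List (Fin n) → Subset n
  grow S [] = S
  grow S (v ∷ vs) with extends? S v
  ... | yes _ = grow (S ∪ ⁅ v ⁆) vs
  ... | no  _ = grow S vs

  grow-⊇ : ∀ S vs → S ⊆ grow S vs
  grow-⊇ S [] x∈ = x∈
  grow-⊇ S (v ∷ vs) x∈ with extends? S v
  ... | yes _ = grow-⊇ (S ∪ ⁅ v ⁆) vs (x∈p∪q⁺ (inj₁ x∈))
  ... | no  _ = grow-⊇ S vs x∈

  add-clique : ∀ S v → IsClique G S → Extends S v → IsClique G (S ∪ ⁅ v ⁆)
  add-clique S v S-cl ext a b a∈ b∈ a≢b with x∈p∪q⁻ S ⁅ v ⁆ a∈ | x∈p∪q⁻ S ⁅ v ⁆ b∈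
  ... | inj₁ a∈S | inj₁ b∈S = S-cl a b a∈S b∈S a≢b
  ... | inj₁ a∈S | inj₂ b∈v rewrite x∈⁅y⁆⇒x≡y v b∈v = ext a a∈S a≢b
  ... | inj₂ a∈v | inj₁ b∈S rewrite x∈⁅y⁆⇒x≡y v a∈v =
    trans (adj-sym v b) (ext b b∈S (λ b≡v → a≢b (sym b≡v)))
  ... | inj₂ a∈v | inj₂ b∈v = ⊥-elim (a≢b (trans (x∈⁅y⁆⇒x≡y v a∈v) (sym (x∈⁅y⁆⇒x≡y v b∈v))))

  grow-clique : ∀ S vs → IsClique G S → IsClique G (grow S vs)
  grow-clique S [] S-cl = S-cl
  grow-clique S (v ∷ vs) S-cl with extends? S v
  ... | yes ext = grow-clique (S ∪ ⁅ v ⁆) vs (add-clique S v S-cl ext)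
  ... | no  _   = grow-clique S vs S-cl

  grow-saturated : ∀ vs S S′ → IsClique G S′ → grow S vs ⊆ S′ →
                   ∀ {v} → v ∈ₗ vs → v ∈ S′ → v ∈ grow S vs
  grow-saturated (x ∷ xs) S S′ S′-cl ⊆S′ v∈vs v∈S′ with extends? S x | v∈vs
  ... | yes _ | here refl = grow-⊇ (S ∪ ⁅ x ⁆) xs (x∈p∪q⁺ (inj₂ (x∈⁅x⁆ x)))
  ... | yes _ | there v∈ = grow-saturated xs (S ∪ ⁅ x ⁆) S′ S′-cl ⊆S′ v∈ v∈S′
  ... | no ¬ext | here refl = ⊥-elim (¬ext (λ u u∈S → S′-cl u x (⊆S′ (grow-⊇ S xs u∈S)) v∈S′))
  ... | no _ | there v∈ = grow-saturated xs S S′ S′-cl ⊆S′ v∈ v∈S′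

  extendToMax : ∀ S → IsClique G S → Σ (Subset n) λ S′ → IsMaxClique G S′ × S ⊆ S′
  extendToMax S S-cl =
    grow S (allFin n) ,
    (grow-clique S (allFin n) S-cl ,
     λ S′ S′-cl ⊆S′ {v} → grow-saturated (allFin n) S S′ S′-cl ⊆S′ (∈-allFin v)) ,
    grow-⊇ S (allFin n)

  edgeInMaxClique : ∀ {y z} → Adj adj y z → Σ (Fin m) λ D → y ∈ clq D × z ∈ clq D
  edgeInMaxClique {y} {z} y~z with extendToMax (⁅ y ⁆ ∪ ⁅ z ⁆) edge-clique
    where
    y-clique : IsClique G ⁅ y ⁆
    y-clique a b a∈ b∈ a≢b = ⊥-elim (a≢b (trans (x∈⁅y⁆⇒x≡y y a∈) (sym (x∈⁅y⁆⇒x≡y y b∈))))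
    edge-clique : IsClique G (⁅ y ⁆ ∪ ⁅ z ⁆)
    edge-clique = add-clique ⁅ y ⁆ z y-clique
      (λ u u∈y _ → subst (λ t → Adj adj t z) (sym (x∈⁅y⁆⇒x≡y y u∈y)) y~z)
  ... | S′ , S′-max , ⊆S′ with complete S′ S′-max
  ...   | D , refl = D , ⊆S′ (x∈p∪q⁺ (inj₁ (x∈⁅x⁆ y))) , ⊆S′ (x∈p∪q⁺ (inj₂ (x∈⁅x⁆ z)))

  privateVertex : ∀ {A B} → A ≢ B → Σ (Fin n) λ a → a ∈ clq A × a ∉ clq B
  privateVertex {A} {B} A≢B with any? (λ a → (a ∈? clq A) ×-dec ¬? (a ∈? clq B))
  ... | yes found = found
  ... | no none =
    ⊥-elim (A≢B (injective A B (⊆-antisym A⊆B (proj₂ (isMax A) (clq B) (proj₁ (isMax B)) A⊆B))))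
    where
    A⊆B : clq A ⊆ clq B
    A⊆B {x} x∈A = decidable-stable (x ∈? clq B) (λ x∉B → none (x , x∈A , x∉B))

  bothIn⇒adjacent : ∀ {x y A} → x ∈ clq A → y ∈ clq A → x ≢ y → Adj adj x y
  bothIn⇒adjacent {x} {y} {A} x∈A y∈A x≢y = proj₁ (isMax A) x y x∈A y∈A x≢y

-- The clique tree T of G seen from a max clique B: the components of T − B
-- (branches) are reached from the neighbours of B, and each vertex of G
-- outside B lives in a single branch.
module CliqueTree {n m} (G : Graph n) (𝓜 : MaxCliqueEnum G m) (E : Fin m → Fin m → Bool)
                  (T : IsCliqueTree G 𝓜 E) where
  open Graph G renaming (sym to adj-sym)
  open MaxCliqueEnum 𝓜
  open IsCliqueTree T renaming (sym to E-sym; irref to E-irref)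
  open Symmetric E-sym using (reverse; neighboursCoincide)
  open MaxCliques G 𝓜 public

  inSubtree : ∀ {v i j} → v ∈ clq i → v ∈ clq j → Path E (λ D → v ∈ clq D) i j
  inSubtree {v} {i} {j} v∈i v∈j = fromWalkWithin (subtree v i j v∈i v∈j)

  avoid : ∀ {v B i j} → v ∉ clq B → Path E (λ D → v ∈ clq D) i j → Path E (_≢ B) i j
  avoid {v} v∉B = weaken (λ {D} v∈D D≡B → v∉B (subst (λ t → v ∈ clq t) D≡B v∈D))

  neighbour≢ : ∀ {B A} → Adj E B A → A ≢ B
  neighbour≢ {B} B~A refl with trans (sym B~A) (E-irref B)
  ... | ()

  -- If y ∈ B lies in a max clique D from which the neighbour A of B is
  -- reachable without passing B, then y ∈ A: the subtree of y must
  -- enter B from the branch of D, which is the branch of A.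
  enterThrough : ∀ {y D A B} → y ∈ clq D → Path E (_≢ B) D A → Adj E B A → y ∈ clq B → y ∈ clq A
  enterThrough {y} {D} {A} {B} y∈D D⇝A B~A y∈B
    with enteringStep (inSubtree y∈D y∈B) (start D⇝A)
  ... | P , P~B , D⇝P = subst (λ t → y ∈ clq t) (sym A≡P) (proj₁ (finish D⇝P))
    where
    A≡P : A ≡ P
    A≡P = neighboursCoincide acyclic B~A (trans (E-sym B P) P~B)
            (reverse D⇝A ++ weaken proj₂ D⇝P)

  sameBranch : ∀ {y z A₁ A₂ B D} → y ∈ clq A₁ → y ∉ clq B → z ∈ clq A₂ → z ∉ clq B →
               y ∈ clq D → z ∈ clq D → Adj E B A₁ → Adj E B A₂ → A₁ ≡ A₂
  sameBranch y∈A₁ y∉B z∈A₂ z∉B y∈D z∈D B~A₁ B~A₂ =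
    neighboursCoincide acyclic B~A₁ B~A₂
      (avoid y∉B (inSubtree y∈A₁ y∈D) ++ avoid z∉B (inSubtree z∈D z∈A₂))

  branchesSeparated : ∀ {y z A₁ A₂ B} → y ∈ clq A₁ → y ∉ clq B → z ∈ clq A₂ → z ∉ clq B →
                      Adj E B A₁ → Adj E B A₂ → A₁ ≢ A₂ → y ≢ z × adj y z ≡ false
  branchesSeparated y∈A₁ y∉B z∈A₂ z∉B B~A₁ B~A₂ A₁≢A₂ =
    (λ { refl → A₁≢A₂ (sameBranch y∈A₁ y∉B z∈A₂ z∉B y∈A₁ y∈A₁ B~A₁ B~A₂) }) ,
    ¬true⇒false λ y~z → let (D , y∈D , z∈D) = edgeInMaxClique y~z in
      A₁≢A₂ (sameBranch y∈A₁ y∉B z∈A₂ z∉B y∈D z∈D B~A₁ B~A₂)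

  adjacentToPrivate : ∀ {a x A B} → a ∈ clq A → a ∉ clq B → x ∈ clq B → Adj adj x a →
                      Adj E B A → x ∈ clq A
  adjacentToPrivate a∈A a∉B x∈B x~a B~A with edgeInMaxClique x~a
  ... | D , x∈D , a∈D = enterThrough x∈D (avoid a∉B (inSubtree a∈D a∈A)) B~A x∈B

  module _ (connected-G : GConnected G) {B A : Fin m} (B~A : Adj E B A) where

    ReachesA : Fin n → Set
    ReachesA y = Σ (Fin m) λ D → y ∈ clq D × Path E (_≢ B) D A

    Meets : Set
    Meets = Σ (Fin n) λ x → x ∈ clq B × x ∈ clq A

    propagate : ∀ {y a} → Path adj (λ _ → ⊤) y a → ReachesA a → ReachesA y ⊎ Meets
    propagate [ _ ] reach = inj₁ reach
    propagate (_∷⟨_⟩_ {j = y′} _ y~y′ ps) reach with propagate ps reach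
    ... | inj₂ meets = inj₂ meets
    ... | inj₁ (D , y′∈D , D⇝A) with y′ ∈? clq B
    ...   | yes y′∈B = inj₂ (y′ , y′∈B , enterThrough y′∈D D⇝A B~A y′∈B)
    ...   | no  y′∉B with edgeInMaxClique y~y′
    ...     | D′ , y∈D′ , y′∈D′ = inj₁ (D′ , y∈D′ , avoid y′∉B (inSubtree y′∈D′ y′∈D) ++ D⇝A)

    adjacentCliquesMeet : ∀ {b} → b ∈ clq B → Meets
    adjacentCliquesMeet {b} b∈B with privateVertex (neighbour≢ B~A)
    ... | a , a∈A , _ with propagate (fromWalk (connected-G b a)) (A , a∈A , [ neighbour≢ B~A ])
    ...   | inj₂ meets = meets
    ...   | inj₁ (D , b∈D , D⇝A) = b , b∈B , enterThrough b∈D D⇝A B~A b∈B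

  module ClawFreeBranches (claw-free : ClawFree G) {B : Fin m} where

    toPrivate : ∀ {x p P} → x ∈ clq B → x ∈ clq P → p ∈ clq P → p ∉ clq B → Adj adj x p
    toPrivate x∈B x∈P p∈P p∉B = bothIn⇒adjacent x∈P p∈P (λ { refl → p∉B x∈B })

    -- No vertex of B lies in three distinct neighbours of B: with private
    -- vertices of the three neighbours it would be the centre of a claw.
    noVertexInThreeBranches : ∀ {x P Q R} → x ∈ clq B → x ∈ clq P → x ∈ clq Q → x ∈ clq R →
                              P ≢ Q → Q ≢ R → P ≢ R → Adj E B P → Adj E B Q → Adj E B R → ⊥
    noVertexInThreeBranches {x} x∈B x∈P x∈Q x∈R P≢Q Q≢R P≢R B~P B~Q B~R
      with privateVertex (neighbour≢ B~P) | privateVertex (neighbour≢ B~Q)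
         | privateVertex (neighbour≢ B~R)
    ... | p , p∈P , p∉B | q , q∈Q , q∉B | r , r∈R , r∉B =
      let (p≢q , p≁q) = branchesSeparated p∈P p∉B q∈Q q∉B B~P B~Q P≢Q
          (q≢r , q≁r) = branchesSeparated q∈Q q∉B r∈R r∉B B~Q B~R Q≢R
          (p≢r , p≁r) = branchesSeparated p∈P p∉B r∈R r∉B B~P B~R P≢R
      in claw-free x p q r (toPrivate x∈B x∈P p∈P p∉B) (toPrivate x∈B x∈Q q∈Q q∉B)
           (toPrivate x∈B x∈R r∈R r∉B) p≢q q≢r p≢r (p≁q , q≁r , p≁r)

    -- If c ∈ B lies in two distinct neighbours P, Q of B, then every vertex
    -- of B lies in P or in Q: otherwise c, private vertices of P and Q and
    -- the vertex form a claw.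
    coveredByTwoBranches : ∀ {c x P Q} → c ∈ clq B → c ∈ clq P → c ∈ clq Q → P ≢ Q →
                           Adj E B P → Adj E B Q → x ∈ clq B → x ∈ clq P ⊎ x ∈ clq Q
    coveredByTwoBranches {c} {x} {P} {Q} c∈B c∈P c∈Q P≢Q B~P B~Q x∈B
      with x ∈? clq P | x ∈? clq Q
    ... | yes x∈P | _       = inj₁ x∈P
    ... | no _    | yes x∈Q = inj₂ x∈Q
    ... | no x∉P  | no x∉Q
      with privateVertex (neighbour≢ B~P) | privateVertex (neighbour≢ B~Q)
    ...   | p , p∈P , p∉B | q , q∈Q , q∉B =
      let (p≢q , p≁q) = branchesSeparated p∈P p∉B q∈Q q∉B B~P B~Q P≢Q
      in ⊥-elim (claw-free c p q x (toPrivate c∈B c∈P p∈P p∉B) (toPrivate c∈B c∈Q q∈Q q∉B)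
                   (bothIn⇒adjacent c∈B x∈B (λ { refl → x∉P c∈P }))
                   p≢q (λ { refl → q∉B x∈B }) (λ { refl → p∉B x∈B })
                   (p≁q , outsideBranch q∈Q q∉B x∉Q B~Q , outsideBranch p∈P p∉B x∉P B~P))
      where
      outsideBranch : ∀ {a A} → a ∈ clq A → a ∉ clq B → x ∉ clq A → Adj E B A → adj a x ≡ false
      outsideBranch {a} a∈A a∉B x∉A B~A =
        ¬true⇒false λ a~x → x∉A (adjacentToPrivate a∈A a∉B x∈B (trans (adj-sym x a) a~x) B~A)

    onlyTwoBranches : ∀ {x J P Q} → x ∈ clq B → x ∈ clq J → Adj E B J →
                      x ∈ clq P → x ∈ clq Q → P ≢ Q → Adj E B P → Adj E B Q → J ≡ P ⊎ J ≡ Q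
    onlyTwoBranches {J = J} {P} {Q} x∈B x∈J B~J x∈P x∈Q P≢Q B~P B~Q
      with J ≟ P | J ≟ Q
    ... | yes J≡P | _       = inj₁ J≡P
    ... | no _    | yes J≡Q = inj₂ J≡Q
    ... | no J≢P  | no J≢Q  =
      ⊥-elim (noVertexInThreeBranches x∈B x∈P x∈Q x∈J P≢Q
                (λ Q≡J → J≢Q (sym Q≡J)) (λ P≡J → J≢P (sym P≡J)) B~P B~Q B~J)

  cliquesOf : ∀ {u X Y Z} → 𝓜Is G 𝓜 u X Y Z → u ∈ clq X × u ∈ clq Y × u ∈ clq Z
  cliquesOf 𝓜u = proj₂ (𝓜u _) (inj₁ refl) , proj₂ (𝓜u _) (inj₂ (inj₁ refl)) ,
               proj₂ (𝓜u _) (inj₂ (inj₂ refl))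

  module _ (connected-G : GConnected G) (claw-free : ClawFree G) where
    open ClawFreeBranches claw-free

    forkNeighbours : ∀ {B A₁ A₂ A₃} → ForkTriangle G 𝓜 E B A₁ A₂ A₃ →
                     ∀ {J} → Adj E B J → J ≡ A₁ ⊎ J ≡ A₂ ⊎ J ≡ A₃
    forkNeighbours (A₁≢A₂ , A₂≢A₃ , A₁≢A₃ , B~A₁ , B~A₂ , B~A₃ , (u , 𝓜u) , (v , 𝓜v) , (w , 𝓜w)) B~J
      with cliquesOf 𝓜u | cliquesOf 𝓜v | cliquesOf 𝓜w
    ... | u∈A₁ , u∈B , u∈A₂ | v∈A₂ , v∈B , v∈A₃ | w∈A₃ , w∈B , w∈A₁
      with adjacentCliquesMeet connected-G B~J u∈B
    ... | x , x∈B , x∈J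
      with coveredByTwoBranches u∈B u∈A₁ u∈A₂ A₁≢A₂ B~A₁ B~A₂ x∈B
         | coveredByTwoBranches v∈B v∈A₂ v∈A₃ A₂≢A₃ B~A₂ B~A₃ x∈B
         | coveredByTwoBranches w∈B w∈A₃ w∈A₁ (λ A₃≡A₁ → A₁≢A₃ (sym A₃≡A₁)) B~A₃ B~A₁ x∈B
    ... | inj₁ x∈A₁ | inj₁ x∈A₂ | _ =
      map₂ inj₁ (onlyTwoBranches x∈B x∈J B~J x∈A₁ x∈A₂ A₁≢A₂ B~A₁ B~A₂)
    ... | inj₁ x∈A₁ | inj₂ x∈A₃ | _ =
      map₂ inj₂ (onlyTwoBranches x∈B x∈J B~J x∈A₁ x∈A₃ A₁≢A₃ B~A₁ B~A₃)
    ... | inj₂ x∈A₂ | inj₁ _ | inj₁ x∈A₃ =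
      inj₂ (onlyTwoBranches x∈B x∈J B~J x∈A₂ x∈A₃ A₂≢A₃ B~A₂ B~A₃)
    ... | inj₂ x∈A₂ | inj₁ _ | inj₂ x∈A₁ =
      map₂ inj₁ (onlyTwoBranches x∈B x∈J B~J x∈A₁ x∈A₂ A₁≢A₂ B~A₁ B~A₂)
    ... | inj₂ x∈A₂ | inj₂ x∈A₃ | _ =
      inj₂ (onlyTwoBranches x∈B x∈J B~J x∈A₂ x∈A₃ A₂≢A₃ B~A₂ B~A₃)

lemma3p12 : ∀ {n m} (G : Graph n) → GConnected G → Chordal G → ClawFree G →
            (𝓜 : MaxCliqueEnum G m) (E : Fin m → Fin m → Bool) →
            IsCliqueTree G 𝓜 E → (B : Fin m) →
            HasForkTriangle G 𝓜 E B → degree G 𝓜 E B ≡ 3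
lemma3p12 G connected-G _ claw-free 𝓜 E T B
  (A₁ , A₂ , A₃ , fork@(A₁≢A₂ , A₂≢A₃ , A₁≢A₃ , B~A₁ , B~A₂ , B~A₃ , _)) =
  ∣p∣≡length (A₁ ∷ A₂ ∷ A₃ ∷ []) distinct
    (λ J∈ → asMember (forkNeighbours connected-G claw-free fork (∈-tabulate⁻ J∈)))
    (∈-tabulate⁺ B~A₁ ∷ ∈-tabulate⁺ B~A₂ ∷ ∈-tabulate⁺ B~A₃ ∷ [])
  where
  open CliqueTree G 𝓜 E T using (forkNeighbours)
  distinct : Unique (A₁ ∷ A₂ ∷ A₃ ∷ [])
  distinct = (A₁≢A₂ ∷ A₁≢A₃ ∷ []) ∷ (A₂≢A₃ ∷ []) ∷ [] ∷ []
  asMember : ∀ {J} → J ≡ A₁ ⊎ J ≡ A₂ ⊎ J ≡ A₃ → J ∈ₗ (A₁ ∷ A₂ ∷ A₃ ∷ [])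
  asMember (inj₁ J≡A₁)        = here J≡A₁
  asMember (inj₂ (inj₁ J≡A₂)) = there (here J≡A₂)
  asMember (inj₂ (inj₂ J≡A₃)) = there (there (here J≡A₃))
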